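{- Let $\mathbf t$ be the Thue--Morse word and $h_{\mathbf t}(n)=\frac1n\sum_{i=0}^{n-1}p_{\mathbf t}(i)$ its periodic complexity function. Then for every integer $n\ge 1$, \[ \frac{3n}{8}-\frac14 \le h_{\mathbf t}(n)\le \frac{3n}{4}+2.\] In particular, $h_{\mathbf t}(n)=\Theta(n)$.
   Context: The Thue--Morse word $\mathbf t=t_0t_1t_2\cdots$ over $\{0,1\}$ is defined by $t_i=0$ if the number of $1$'s in the binary representation of $i$ is even, and $t_i=1$ otherwise. For an infinite word $\mathbf w=w_0w_1w_2\cdots$, the periodicity function $p_{\mathbf w}(i)$ is the length of the shortest nonempty prefix $u$ of $w_iw_{i+1}w_{i+2}\cdots$ such that either $u$ is a suffix of $w_0\cdots w_{i-1}$ or $w_0\cdots w_{i-1}$ is a suffix of $u$ (for $i=0$, $w_0\cdots w_{i-1}$ is the empty word); if no such $u$ exists, $p_{\mathbf w}(i)=\infty$ (this does not occur for recurrent words such as $\mathbf t$). -}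

module Defs where

open import Data.Nat using (ℕ; zero; suc; _+_; _*_; _∸_; _≤_; _<_)
open import Data.Nat.DivMod using (_/_; _%_)
open import Data.List using (List; []; _∷_; map; upTo; applyUpTo)
open import Data.Nat.ListAction using (sum)
open import Data.List.Relation.Binary.Suffix.Heterogeneous using (Suffix)
open import Data.Product using (_×_)
open import Data.Sum using (_⊎_)
open import Relation.Binary.PropositionalEquality using (_≡_)
open import Relation.Nullary using (¬_)

-- Binary digits (least significant first) of n, computed with fuel f ≥ n.
bitsFuel : ℕ → ℕ → List ℕ
bitsFuel zero    n       = []
bitsFuel (suc f) zero    = []
bitsFuel (suc f) (suc n) = (suc n % 2) ∷ bitsFuel f (suc n / 2)

binary : ℕ → List ℕ
binary n = bitsFuel n n

numOnes : ℕ → ℕ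
numOnes n = sum (binary n)

Word : Set → Set
Word A = ℕ → A

thueMorse : Word ℕ
thueMorse i = numOnes i % 2

factor : {A : Set} → Word A → ℕ → ℕ → List A
factor w i k = applyUpTo (λ j → w (i + j)) k

prefix : {A : Set} → Word A → ℕ → List A
prefix w i = factor w 0 i

_IsSuffixOf_ : {A : Set} → List A → List A → Set
xs IsSuffixOf ys = Suffix _≡_ xs ys

PeriodCandidate : {A : Set} → Word A → ℕ → ℕ → Set
PeriodCandidate w i k =
  1 ≤ k × ((factor w i k IsSuffixOf prefix w i) ⊎ (prefix w i IsSuffixOf factor w i k))

-- p_w(i) = k : k is the length of the shortest such nonempty prefix u.
IsPeriodicity : {A : Set} → Word A → ℕ → ℕ → Set
IsPeriodicity w i k =
  PeriodCandidate w i k × (∀ j → j < k → ¬ PeriodCandidate w i j)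

sumTo : (ℕ → ℕ) → ℕ → ℕ
sumTo p n = sum (map p (upTo n))

-- The Thue–Morse word is the fixed point of 0 ↦ 01, 1 ↦ 10: it is a sequence of
-- blocks t(2n) t(2n+1) = t(n) t̄(n). At an even position 2z either the preceding
-- letter equals t(2z) (period 1), or t(z-1) = t(z) and the block before 2z equals
-- the block at 2z (period 2); so p(2z) ≤ 2. If 2^e ≤ i < 2^(e+1), the prefix of
-- length 2^(e+1) reoccurs at 3·2^e, so p(i) ≤ 3i. At an odd position i every
-- candidate has length k ≥ 3i/2. A candidate with k ≤ i is the second half of a
-- square centred at i, and t has no square with odd centre: odd-length squares
-- cannot start at even positions, and halving an even-length square at an odd
-- position yields a shorter square with odd centre. A candidate with k ≥ i is an
-- occurrence of the prefix of length i at position k, and halving such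
-- occurrences shows 3i ≤ 2k. Summing over pairs of consecutive positions, one of
-- which is odd, gives both bounds.

module Submission where

open import Defs
open import Data.Bool.Base using (Bool; not)
open import Data.Bool.Properties using (not-¬; ¬-not; not-injective; not-involutive)
  renaming (_≟_ to _≟ᵇ_)
open import Data.Empty using (⊥-elim)
open import Data.List.Base using ([]; _∷_; _++_; applyUpTo; map; upTo)
open import Data.List.Properties using (applyUpTo-∷ʳ; map-++)
open import Data.List.Relation.Binary.Pointwise as Pointwise using (Pointwise)
open import Data.List.Relation.Binary.Suffix.Heterogeneous using (Suffix; here; there)
open import Data.List.Relation.Binary.Suffix.Heterogeneous.Properties using (suffix?)
open import Data.Nat.Base hiding (parity)
open import Data.Nat.DivMod using (_/_; _%_; m/n<m; m*n%n≡0; m*n/n≡m; [m+kn]%n≡m%n; +-distrib-/-∣ʳ)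
open import Data.Nat.Divisibility using (divides)
open import Data.Nat.Induction using (<-wellFounded)
open import Data.Nat.ListAction using (sum)
open import Data.Nat.ListAction.Properties using (sum-++)
open import Data.Nat.Properties
open import Data.Nat.Tactic.RingSolver using (solve)
open import Data.Product using (Σ; ∃-syntax; _×_; _,_; proj₁; proj₂)
open import Data.Sum using (_⊎_; inj₁; inj₂; [_,_])
open import Function.Base using (_∘_)
open import Induction.WellFounded using (Acc; acc)
open import Relation.Binary.Definitions using (DecidableEquality)
open import Relation.Binary.PropositionalEquality
  using (_≡_; _≢_; refl; sym; trans; cong; cong₂; subst; module ≡-Reasoning)
open import Relation.Nullary using (¬_; Dec; yes; no)
open import Relation.Nullary.Decidable using (_×-dec_; _⊎-dec_)

≤-offset : ∀ {m n} o → m + o ≡ n → m ≤ n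
≤-offset {m} o refl = m≤m+n m o

[1+n]/2≤n : ∀ n → suc n / 2 ≤ n
[1+n]/2≤n n = ≤-pred (m/n<m (suc n) 2 (s≤s (s≤s z≤n)))

bitsFuel-irrelevant : ∀ {f g} n → n ≤ f → n ≤ g → bitsFuel f n ≡ bitsFuel g n
bitsFuel-irrelevant {zero}  {zero}  zero _ _ = refl
bitsFuel-irrelevant {zero}  {suc _} zero _ _ = refl
bitsFuel-irrelevant {suc _} {zero}  zero _ _ = refl
bitsFuel-irrelevant {suc _} {suc _} zero _ _ = refl
bitsFuel-irrelevant {suc f} {suc g} (suc n) (s≤s n≤f) (s≤s n≤g) =
  cong (suc n % 2 ∷_)
       (bitsFuel-irrelevant (suc n / 2) (≤-trans ([1+n]/2≤n n) n≤f) (≤-trans ([1+n]/2≤n n) n≤g))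

numOnes-unfold : ∀ n → numOnes n ≡ n % 2 + numOnes (n / 2)
numOnes-unfold zero    = refl
numOnes-unfold (suc n) =
  cong (λ bs → suc n % 2 + sum bs) (bitsFuel-irrelevant (suc n / 2) ([1+n]/2≤n n) ≤-refl)

numOnes-2* : ∀ n → numOnes (2 * n) ≡ numOnes n
numOnes-2* n rewrite *-comm 2 n =
  trans (numOnes-unfold (n * 2)) (cong₂ (λ r q → r + numOnes q) (m*n%n≡0 n 2) (m*n/n≡m n 2))

numOnes-1+2* : ∀ n → numOnes (1 + 2 * n) ≡ 1 + numOnes n
numOnes-1+2* n rewrite *-comm 2 n =
  trans (numOnes-unfold (1 + n * 2))
        (cong₂ (λ r q → r + numOnes q) ([m+kn]%n≡m%n 1 n 2)
               (trans (+-distrib-/-∣ʳ 1 {d = 2} (divides n refl)) (m*n/n≡m n 2)))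

odd-suc : ∀ x → (suc x % 2 ≡ᵇ 1) ≡ not (x % 2 ≡ᵇ 1)
odd-suc zero          = refl
odd-suc (suc zero)    = refl
odd-suc (suc (suc x)) = odd-suc x

%2-≡ᵇ1-injective : ∀ x y → (x % 2 ≡ᵇ 1) ≡ (y % 2 ≡ᵇ 1) → x % 2 ≡ y % 2
%2-≡ᵇ1-injective (suc (suc x)) y             e = %2-≡ᵇ1-injective x y e
%2-≡ᵇ1-injective zero          (suc (suc y)) e = %2-≡ᵇ1-injective zero y e
%2-≡ᵇ1-injective (suc zero)    (suc (suc y)) e = %2-≡ᵇ1-injective (suc zero) y e
%2-≡ᵇ1-injective zero          zero          _ = refl
%2-≡ᵇ1-injective (suc zero)    (suc zero)    _ = refl

-- Opaque, so that a goal t x ≡ t y fixes x and y by unification.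
opaque
  t : Word Bool
  t n = thueMorse n ≡ᵇ 1

  t-2* : ∀ n → t (2 * n) ≡ t n
  t-2* n = cong (λ x → x % 2 ≡ᵇ 1) (numOnes-2* n)

  t-1+2* : ∀ n → t (1 + 2 * n) ≡ not (t n)
  t-1+2* n = trans (cong (λ x → x % 2 ≡ᵇ 1) (numOnes-1+2* n)) (odd-suc (numOnes n))

  thueMorse≡⇒t≡ : ∀ {m n} → thueMorse m ≡ thueMorse n → t m ≡ t n
  thueMorse≡⇒t≡ = cong (_≡ᵇ 1)

  t≡⇒thueMorse≡ : ∀ {m n} → t m ≡ t n → thueMorse m ≡ thueMorse n
  t≡⇒thueMorse≡ {m} {n} = %2-≡ᵇ1-injective (numOnes m) (numOnes n)

data Parity : ℕ → Set where
  even : ∀ q → Parity (2 * q)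
  odd  : ∀ q → Parity (1 + 2 * q)

parity : ∀ n → Parity n
parity zero = even 0
parity (suc n) with parity n
... | even q = odd q
... | odd q  = subst Parity 2*[1+q]≡2+2*q (even (1 + q))
  where
  2*[1+q]≡2+2*q : 2 * (1 + q) ≡ 2 + 2 * q
  2*[1+q]≡2+2*q = solve (q ∷ [])

t-2*≢t-1+2* : ∀ n → t (2 * n) ≢ t (1 + 2 * n)
t-2*≢t-1+2* n e = not-¬ refl (trans (sym (t-2* n)) (trans e (t-1+2* n)))

t-boundary : ∀ n → t (1 + 2 * n) ≢ t (2 * (1 + n)) → t n ≡ t (1 + n)
t-boundary n ne = not-injective (¬-not λ e → ne (trans (t-1+2* n) (trans e (sym (t-2* (1 + n))))))

t-no-triple : ∀ n → t n ≡ t (1 + n) → t (1 + n) ≢ t (2 + n)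
t-no-triple n e₁ e₂ with parity n
... | even q = t-2*≢t-1+2* q e₁
... | odd q  = t-2*≢t-1+2* (1 + q) (begin
  t (2 * (1 + q))     ≡⟨ cong t (solve (q ∷ [])) ⟩
  t (2 + 2 * q)       ≡⟨ e₂ ⟩
  t (3 + 2 * q)       ≡⟨ cong t (solve (q ∷ [])) ⟩
  t (1 + 2 * (1 + q)) ∎)
  where open ≡-Reasoning

module _ {A : Set} where

  Pointwise-applyUpTo⁻ : ∀ {f g : ℕ → A} k n → Pointwise _≡_ (applyUpTo f k) (applyUpTo g n) →
                         k ≡ n × (∀ d → d < k → f d ≡ g d)
  Pointwise-applyUpTo⁻ zero    zero    Pointwise.[] = refl , λ _ ()
  Pointwise-applyUpTo⁻ (suc k) (suc n) (e Pointwise.∷ es) with Pointwise-applyUpTo⁻ k n es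
  ... | refl , h = refl , λ { zero _ → e ; (suc d) d<k → h d (s<s⁻¹ d<k) }

  Pointwise-applyUpTo⁺ : ∀ {f g : ℕ → A} k → (∀ d → d < k → f d ≡ g d) →
                         Pointwise _≡_ (applyUpTo f k) (applyUpTo g k)
  Pointwise-applyUpTo⁺ zero    h = Pointwise.[]
  Pointwise-applyUpTo⁺ (suc k) h =
    h 0 z<s Pointwise.∷ Pointwise-applyUpTo⁺ k (λ d d<k → h (suc d) (s<s d<k))

  Suffix-applyUpTo⁻ : ∀ {f g : ℕ → A} k n → Suffix _≡_ (applyUpTo f k) (applyUpTo g n) →
                      ∃[ j ] n ≡ j + k × (∀ d → d < k → f d ≡ g (j + d))
  Suffix-applyUpTo⁻ zero    zero    _ = 0 , refl , λ _ ()
  Suffix-applyUpTo⁻ (suc k) zero    (here ())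
  Suffix-applyUpTo⁻ {f} {g} k (suc n) (here eqs) with Pointwise-applyUpTo⁻ {f = f} {g} k (suc n) eqs
  ... | refl , h = 0 , refl , h
  Suffix-applyUpTo⁻ k         (suc n) (there s) with Suffix-applyUpTo⁻ k n s
  ... | j , refl , h = suc j , refl , h

  Suffix-applyUpTo⁺ : ∀ {f g : ℕ → A} k j → (∀ d → d < k → f d ≡ g (j + d)) →
                      Suffix _≡_ (applyUpTo f k) (applyUpTo g (j + k))
  Suffix-applyUpTo⁺ k zero    h = here (Pointwise-applyUpTo⁺ k h)
  Suffix-applyUpTo⁺ k (suc j) h = there (Suffix-applyUpTo⁺ k j h)

module _ {P : ℕ → Set} (P? : ∀ n → Dec (P n)) where

  least-below : ∀ n → (∃[ k ] P k × (∀ j → j < k → ¬ P j)) ⊎ (∀ j → j < n → ¬ P j)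
  least-below zero = inj₂ λ _ ()
  least-below (suc n) with least-below n
  ... | inj₁ least = inj₁ least
  ... | inj₂ none with P? n
  ...   | yes pn  = inj₁ (n , pn , none)
  ...   | no  ¬pn = inj₂ λ j j<1+n →
    [ none j , (λ { refl → ¬pn }) ] (m≤n⇒m<n∨m≡n (s≤s⁻¹ j<1+n))

  least : ∀ {n} → P n → ∃[ k ] P k × (∀ j → j < k → ¬ P j)
  least {n} pn with least-below (suc n)
  ... | inj₁ found = found
  ... | inj₂ none  = ⊥-elim (none n (n<1+n n) pn)

module _ {A : Set} (w : Word A) where

  Square : ℕ → ℕ → Set
  Square a k = ∀ d → d < k → w (a + d) ≡ w (a + k + d)

  PrefixAt : ℕ → ℕ → Set
  PrefixAt k m = ∀ d → d < m → w d ≡ w (k + d)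

  square-at : ∀ {a k x y} → Square a k → ∀ d → d < k → x ≡ a + d → y ≡ a + k + d → w x ≡ w y
  square-at sq d d<k refl refl = sq d d<k

  prefixAt-at : ∀ {k m y} → PrefixAt k m → ∀ d → d < m → y ≡ k + d → w d ≡ w y
  prefixAt-at occ d d<m refl = occ d d<m

  square-shift : ∀ {a k} → Square a k → w (a + k) ≡ w (a + k + k) → Square (1 + a) k
  square-shift {a} {k} sq edge d 1+d≤k with m≤n⇒m<n∨m≡n 1+d≤k
  ... | inj₁ 1+d<k = square-at sq (1 + d) 1+d<k (solve (a ∷ d ∷ [])) (solve (a ∷ k ∷ d ∷ []))
  ... | inj₂ refl  = begin
    w (1 + a + d)     ≡⟨ cong w (solve (a ∷ d ∷ [])) ⟩
    w (a + k)         ≡⟨ edge ⟩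
    w (a + k + k)     ≡⟨ cong w (solve (a ∷ d ∷ [])) ⟩
    w (1 + a + k + d) ∎
    where open ≡-Reasoning

  candidate⇒ : ∀ {i k} → PeriodCandidate w i k →
               (∃[ j ] i ≡ j + k × Square j k) ⊎ (∃[ j ] k ≡ j + i × PrefixAt k i)
  candidate⇒ {i} {k} (_ , inj₁ s) with Suffix-applyUpTo⁻ k i s
  ... | j , refl , h = inj₁ (j , refl , λ d d<k → sym (h d d<k))
  candidate⇒ {i} {k} (_ , inj₂ s) with Suffix-applyUpTo⁻ i k s
  ... | j , refl , h = inj₂ (j , refl , λ d d<i → trans (h d d<i) (cong w (solve (i ∷ j ∷ d ∷ []))))

  square⇒candidate : ∀ {i j k} → 1 ≤ k → Square j k → i ≡ j + k → PeriodCandidate w i k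
  square⇒candidate k≥1 sq refl = k≥1 , inj₁ (Suffix-applyUpTo⁺ _ _ λ d d<k → sym (sq d d<k))

  prefixAt⇒candidate : ∀ {i k} → 1 ≤ k → i ≤ k → PrefixAt k i → PeriodCandidate w i k
  prefixAt⇒candidate {i} {k} k≥1 i≤k occ with m≤n⇒∃[o]m+o≡n i≤k
  ... | o , refl = k≥1 , inj₂ (subst (Suffix _≡_ (prefix w i) ∘ applyUpTo (λ d → w (i + d)))
                                     (+-comm o i)
                                     (Suffix-applyUpTo⁺ i o λ d d<i →
                                        trans (occ d d<i) (cong w (+-assoc i o d))))

  periodCandidate? : DecidableEquality A → ∀ i k → Dec (PeriodCandidate w i k)
  periodCandidate? _≟_ i k = (1 ≤? k) ×-dec (suffix? _≟_ _ _ ⊎-dec suffix? _≟_ _ _)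

  periodicity-exists : DecidableEquality A → ∀ {i k} → PeriodCandidate w i k →
                       ∃[ p ] IsPeriodicity w i p
  periodicity-exists _≟_ {i} = least (periodCandidate? _≟_ i)

  periodicity-≤ : ∀ {i p k} → IsPeriodicity w i p → PeriodCandidate w i k → p ≤ k
  periodicity-≤ (_ , shortest) c = ≮⇒≥ λ k<p → shortest _ k<p c

module _ {A B : Set} (v : Word A) (w : Word B) (v≡⇒w≡ : ∀ {x y} → v x ≡ v y → w x ≡ w y) where

  square-map : ∀ {a k} → Square v a k → Square w a k
  square-map sq d d<k = v≡⇒w≡ (sq d d<k)

  prefixAt-map : ∀ {k m} → PrefixAt v k m → PrefixAt w k m
  prefixAt-map occ d d<m = v≡⇒w≡ (occ d d<m)

prefixAt-≤ : ∀ {A} {w : Word A} {k m m′} → m′ ≤ m → PrefixAt w k m → PrefixAt w k m′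
prefixAt-≤ m′≤m occ d d<m′ = occ d (≤-trans d<m′ m′≤m)

-- A shift by an odd length carries the two letters of a block onto the two
-- sides of a block boundary, which therefore differ; by t-boundary this
-- forces three equal letters in a row.
no-odd-square-at-even : ∀ b j → ¬ Square t (2 * b) (1 + 2 * j)
no-odd-square-at-even b zero sq =
  t-2*≢t-1+2* b (square-at t sq 0 z<s (solve (b ∷ [])) (solve (b ∷ [])))
no-odd-square-at-even b (suc j) sq = t-no-triple (b + j) left right
  where
  open ≡-Reasoning
  left : t (b + j) ≡ t (1 + (b + j))
  left = t-boundary (b + j) λ e → t-2*≢t-1+2* (2 + b + 2 * j) (begin
    t (2 * (2 + b + 2 * j))
      ≡⟨ square-at t sq (1 + 2 * j) (≤-offset 1 (solve (j ∷ [])))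
                   (solve (b ∷ j ∷ [])) (solve (b ∷ j ∷ [])) ⟨
    t (1 + 2 * (b + j))
      ≡⟨ e ⟩
    t (2 * (1 + (b + j)))
      ≡⟨ square-at t sq (2 + 2 * j) (≤-reflexive (solve (j ∷ [])))
                   (solve (b ∷ j ∷ [])) (solve (b ∷ j ∷ [])) ⟩
    t (1 + 2 * (2 + b + 2 * j))
      ∎)
  right : t (1 + (b + j)) ≡ t (2 + (b + j))
  right = t-boundary (1 + (b + j)) λ e → t-2*≢t-1+2* b (begin
    t (2 * b)
      ≡⟨ square-at t sq 0 z<s (solve (b ∷ [])) (solve (b ∷ j ∷ [])) ⟩
    t (1 + 2 * (1 + (b + j)))
      ≡⟨ e ⟩
    t (2 * (2 + (b + j)))
      ≡⟨ square-at t sq 1 (s<s z<s) (solve (b ∷ [])) (solve (b ∷ j ∷ [])) ⟨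
    t (1 + 2 * b)
      ∎)

square-halve : ∀ {b j} → Square t (1 + 2 * b) (2 * j) → Square t b j
square-halve {b} {j} sq d d<j = not-injective (begin
  not (t (b + d))
    ≡⟨ t-1+2* (b + d) ⟨
  t (1 + 2 * (b + d))
    ≡⟨ square-at t sq (2 * d) (*-monoʳ-< 2 d<j) (solve (b ∷ d ∷ [])) (solve (b ∷ j ∷ d ∷ [])) ⟩
  t (1 + 2 * (b + j + d))
    ≡⟨ t-1+2* (b + j + d) ⟩
  not (t (b + j + d))
    ∎)
  where open ≡-Reasoning

square-halve-shifted : ∀ {b j} → Square t (1 + 2 * b) (2 * j) → Square t (1 + b) j
square-halve-shifted {b} {zero}  sq = λ _ ()
square-halve-shifted {b} {suc j} sq = square-shift t (square-halve sq) (begin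
  t (b + suc j)
    ≡⟨ t-2* (b + suc j) ⟨
  t (2 * (b + suc j))
    ≡⟨ square-at t sq (1 + 2 * j) (≤-reflexive (solve (j ∷ [])))
                 (solve (b ∷ j ∷ [])) (solve (b ∷ j ∷ [])) ⟩
  t (2 * (b + suc j + suc j))
    ≡⟨ t-2* (b + suc j + suc j) ⟩
  t (b + suc j + suc j)
    ∎)
  where open ≡-Reasoning

even+even≢odd : ∀ b j m → 2 * b + 2 * j ≢ 1 + 2 * m
even+even≢odd b j m e = even≢odd (b + j) m (trans 2*-distrib e)
  where
  2*-distrib : 2 * (b + j) ≡ 2 * b + 2 * j
  2*-distrib = solve (b ∷ j ∷ [])

odd+odd≢odd : ∀ b j m → (1 + 2 * b) + (1 + 2 * j) ≢ 1 + 2 * m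
odd+odd≢odd b j m e = even≢odd (1 + b + j) m (trans 2*-distrib e)
  where
  2*-distrib : 2 * (1 + b + j) ≡ (1 + 2 * b) + (1 + 2 * j)
  2*-distrib = solve (b ∷ j ∷ [])

odd+even≡odd⇒ : ∀ b j m → (1 + 2 * b) + 2 * j ≡ 1 + 2 * m → b + j ≡ m
odd+even≡odd⇒ b j m e = *-cancelˡ-≡ (b + j) m 2 (suc-injective (trans 2*-distrib e))
  where
  2*-distrib : 1 + 2 * (b + j) ≡ (1 + 2 * b) + 2 * j
  2*-distrib = solve (b ∷ j ∷ [])

no-square-with-odd-centre : ∀ {m} → Acc _<_ m → ∀ a k → 1 ≤ k → a + k ≡ 1 + 2 * m → ¬ Square t a k
no-square-with-odd-centre {m} (acc rec) a k k≥1 centre sq with parity a | parity k | parity m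
... | even b | odd j  | _ = no-odd-square-at-even b j sq
... | even b | even j | _ = even+even≢odd b j m centre
... | odd b  | odd j  | _ = odd+odd≢odd b j m centre
... | odd b  | even zero    | _ = n≮0 k≥1
... | odd b  | even (suc j) | odd q =
  no-square-with-odd-centre (rec (s≤s (m≤m+n q _))) b (suc j) z<s
    (odd+even≡odd⇒ b (suc j) _ centre) (square-halve sq)
... | odd b  | even (suc j) | even zero =
  0≢1+n (trans (sym (odd+even≡odd⇒ b (suc j) 0 centre)) (+-suc b j))
... | odd b  | even (suc j) | even (suc q) =
  no-square-with-odd-centre (rec (s≤s (m<m+n q z<s))) (1 + b) (suc j) z<s
    (cong suc (odd+even≡odd⇒ b (suc j) _ centre)) (square-halve-shifted sq)

prefixAt-halve : ∀ {c m e} → 2 * e ≤ 1 + m → PrefixAt t (2 * c) m → PrefixAt t c e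
prefixAt-halve {c} {m} {e} 2e≤1+m occ d d<e = begin
  t d             ≡⟨ t-2* d ⟨
  t (2 * d)       ≡⟨ prefixAt-at t occ (2 * d) 2d<m (solve (c ∷ d ∷ [])) ⟩
  t (2 * (c + d)) ≡⟨ t-2* (c + d) ⟩
  t (c + d)       ∎
  where
  open ≡-Reasoning
  2+2d≡2[1+d] : 2 + 2 * d ≡ 2 * (1 + d)
  2+2d≡2[1+d] = solve (d ∷ [])
  2d<m : 2 * d < m
  2d<m = s≤s⁻¹ (≤-trans (≤-reflexive 2+2d≡2[1+d]) (≤-trans (*-monoʳ-≤ 2 d<e) 2e≤1+m))

prefixAt-double : ∀ {k m} → PrefixAt t k m → PrefixAt t (2 * k) (2 * m)
prefixAt-double {k} {m} occ d d<2m with parity d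
... | even e = begin
  t (2 * e)         ≡⟨ t-2* e ⟩
  t e               ≡⟨ occ e (*-cancelˡ-< 2 e m d<2m) ⟩
  t (k + e)         ≡⟨ t-2* (k + e) ⟨
  t (2 * (k + e))   ≡⟨ cong t (solve (k ∷ e ∷ [])) ⟩
  t (2 * k + 2 * e) ∎
  where open ≡-Reasoning
... | odd e = begin
  t (1 + 2 * e)           ≡⟨ t-1+2* e ⟩
  not (t e)               ≡⟨ cong not (occ e (*-cancelˡ-< 2 e m (<-trans (n<1+n (2 * e)) d<2m))) ⟩
  not (t (k + e))         ≡⟨ t-1+2* (k + e) ⟨
  t (1 + 2 * (k + e))     ≡⟨ cong t (solve (k ∷ e ∷ [])) ⟩
  t (2 * k + (1 + 2 * e)) ∎
  where open ≡-Reasoning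

prefixAt-3*2^ : ∀ e → PrefixAt t (3 * 2 ^ e) (2 * 2 ^ e)
prefixAt-3*2^ zero zero _ = begin
  t 0             ≡⟨ not-involutive (t 0) ⟨
  not (not (t 0)) ≡⟨ cong not (t-1+2* 0) ⟨
  not (t 1)       ≡⟨ t-1+2* 1 ⟨
  t 3             ∎
  where open ≡-Reasoning
prefixAt-3*2^ zero (suc zero) _ = trans (sym (t-2* 1)) (sym (t-2* 2))
prefixAt-3*2^ zero (suc (suc d)) (s≤s (s≤s ()))
prefixAt-3*2^ (suc e) = subst (λ k → PrefixAt t k (2 * 2 ^ suc e)) (2*[3*n]≡3*[2*n] (2 ^ e))
                              (prefixAt-double (prefixAt-3*2^ e))
  where
  2*[3*n]≡3*[2*n] : ∀ n → 2 * (3 * n) ≡ 3 * (2 * n)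
  2*[3*n]≡3*[2*n] n = solve (n ∷ [])

2^-bracket : ∀ i → 1 ≤ i → ∃[ e ] 2 ^ e ≤ i × i < 2 * 2 ^ e
2^-bracket (suc zero)    _ = 0 , ≤-refl , s<s z<s
2^-bracket (suc (suc i)) _ with 2^-bracket (suc i) z<s
... | e , lo , hi with m≤n⇒m<n∨m≡n hi
...   | inj₁ 2+i<2^[1+e] = e , m≤n⇒m≤1+n lo , 2+i<2^[1+e]
...   | inj₂ 2+i≡2^[1+e] = suc e , ≤-reflexive (sym 2+i≡2^[1+e]) ,
                           subst (λ x → 2 + i < 2 * x) 2+i≡2^[1+e] (m<m+n (2 + i) z<s)

prefixAt-odd-bound : ∀ {c m} → 1 ≤ m → m ≤ 1 + 2 * c → PrefixAt t (1 + 2 * c) m →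
                     3 * m ≤ 2 * (1 + 2 * c)
prefixAt-odd-bound {zero}  {1} _ _ occ = ⊥-elim (t-2*≢t-1+2* 0 (occ 0 z<s))
prefixAt-odd-bound {suc c} {1} _ _ _   = ≤-offset (3 + 4 * c) (solve (c ∷ []))
prefixAt-odd-bound {zero}  {2} _ (s≤s ()) _
prefixAt-odd-bound {suc c} {2} _ _ _   = ≤-offset (4 * c) (solve (c ∷ []))
prefixAt-odd-bound {c} {suc (suc (suc m))} _ _ occ = ⊥-elim (t-2*≢t-1+2* (1 + c) (begin
  t (2 * (1 + c))     ≡⟨ prefixAt-at t occ 1 (s<s z<s) (solve (c ∷ [])) ⟨
  t 1                 ≡⟨ t-2* 1 ⟨
  t 2                 ≡⟨ prefixAt-at t occ 2 (s<s (s<s z<s)) (solve (c ∷ [])) ⟩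
  t (1 + 2 * (1 + c)) ∎))
  where open ≡-Reasoning

prefixAt-bound : ∀ {m} → Acc _<_ m → ∀ k → 1 ≤ m → m ≤ k → PrefixAt t k m → 3 * m ≤ 2 * k
prefixAt-bound {m} (acc rec) k m≥1 m≤k occ with parity k | parity m
... | odd c  | _ = prefixAt-odd-bound {c} m≥1 m≤k occ
... | even c | even zero = ⊥-elim (n≮0 m≥1)
... | even c | even (suc e) = begin
  3 * (2 * suc e) ≡⟨ solve (e ∷ []) ⟩
  2 * (3 * suc e) ≤⟨ *-monoʳ-≤ 2 (prefixAt-bound (rec (s≤s (m<m+n e z<s))) c z<s
                                   (*-cancelˡ-≤ 2 m≤k) (prefixAt-halve {c} (n≤1+n _) occ)) ⟩
  2 * (2 * c)     ∎
  where open ≤-Reasoning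
... | even zero    | odd zero = ⊥-elim (n≮0 m≤k)
... | even (suc c) | odd zero = ≤-offset (1 + 4 * c) (solve (c ∷ []))
... | even c | odd (suc e) = begin
  3 * (1 + 2 * (1 + e)) ≤⟨ ≤-offset 3 (solve (e ∷ [])) ⟩
  2 * (3 * (2 + e))     ≤⟨ *-monoʳ-≤ 2 (prefixAt-bound (rec 2+e<m) c z<s
                                         (*-cancelˡ-< 2 _ c m≤k)
                                         (prefixAt-halve {c} 2[2+e]≤1+m occ)) ⟩
  2 * (2 * c)           ∎
  where
  open ≤-Reasoning
  2+e<m : 2 + e < 1 + 2 * (1 + e)
  2+e<m = ≤-offset e (solve (e ∷ []))
  2[2+e]≤1+m : 2 * (2 + e) ≤ 1 + (1 + 2 * (1 + e))
  2[2+e]≤1+m = ≤-reflexive (solve (e ∷ []))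

candidate-even : ∀ z → ∃[ k ] k ≤ 2 × PeriodCandidate thueMorse (2 * z) k
candidate-even zero = 1 , s≤s z≤n , prefixAt⇒candidate thueMorse z<s z≤n (λ _ ())
candidate-even (suc z) with t (1 + 2 * z) ≟ᵇ t (2 * (1 + z))
... | yes same = 1 , s≤s z≤n ,
  square⇒candidate thueMorse {i = 2 * (1 + z)} {j = 1 + 2 * z} z<s
    (square-map t thueMorse t≡⇒thueMorse≡ square) (solve (z ∷ []))
  where
  open ≡-Reasoning
  square : Square t (1 + 2 * z) 1
  square zero _ = begin
    t (1 + 2 * z + 0)     ≡⟨ cong t (solve (z ∷ [])) ⟩
    t (1 + 2 * z)         ≡⟨ same ⟩
    t (2 * (1 + z))       ≡⟨ cong t (solve (z ∷ [])) ⟩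
    t (1 + 2 * z + 1 + 0) ∎
  square (suc _) (s≤s ())
... | no differ = 2 , ≤-refl ,
  square⇒candidate thueMorse {i = 2 * (1 + z)} {j = 2 * z} z<s
    (square-map t thueMorse t≡⇒thueMorse≡ square) (solve (z ∷ []))
  where
  open ≡-Reasoning
  t-z≡t-1+z : t z ≡ t (1 + z)
  t-z≡t-1+z = t-boundary z differ
  square : Square t (2 * z) 2
  square zero _ = begin
    t (2 * z + 0)           ≡⟨ cong t (solve (z ∷ [])) ⟩
    t (2 * z)               ≡⟨ t-2* z ⟩
    t z                     ≡⟨ t-z≡t-1+z ⟩
    t (1 + z)               ≡⟨ t-2* (1 + z) ⟨
    t (2 * (1 + z))         ≡⟨ cong t (solve (z ∷ [])) ⟩
    t (2 * z + 2 + 0)       ∎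
  square (suc zero) _ = begin
    t (2 * z + 1)           ≡⟨ cong t (solve (z ∷ [])) ⟩
    t (1 + 2 * z)           ≡⟨ t-1+2* z ⟩
    not (t z)               ≡⟨ cong not t-z≡t-1+z ⟩
    not (t (1 + z))         ≡⟨ t-1+2* (1 + z) ⟨
    t (1 + 2 * (1 + z))     ≡⟨ cong t (solve (z ∷ [])) ⟩
    t (2 * z + 2 + 1)       ∎
  square (suc (suc _)) (s≤s (s≤s ()))

candidate-≤3* : ∀ i → 1 ≤ i → ∃[ k ] k ≤ 3 * i × PeriodCandidate thueMorse i k
candidate-≤3* i i≥1 with 2^-bracket i i≥1
... | e , 2^e≤i , i<2^[1+e] = 3 * 2 ^ e , *-monoʳ-≤ 3 2^e≤i ,
  prefixAt⇒candidate thueMorse (≤-trans i≥1 i≤3*2^e) i≤3*2^e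
    (prefixAt-map t thueMorse t≡⇒thueMorse≡ (prefixAt-≤ (<⇒≤ i<2^[1+e]) (prefixAt-3*2^ e)))
  where
  i≤3*2^e : i ≤ 3 * 2 ^ e
  i≤3*2^e = ≤-trans (<⇒≤ i<2^[1+e]) (*-monoˡ-≤ (2 ^ e) (n≤1+n 2))

candidate-odd-bound : ∀ {n k} → PeriodCandidate thueMorse (1 + 2 * n) k → 3 * (1 + 2 * n) ≤ 2 * k
candidate-odd-bound {n} {k} c with candidate⇒ thueMorse c
... | inj₁ (j , centre , square) = ⊥-elim (no-square-with-odd-centre (<-wellFounded n) j k (proj₁ c)
  (sym centre) (square-map thueMorse t thueMorse≡⇒t≡ square))
... | inj₂ (j , refl , occ) =
  prefixAt-bound (<-wellFounded _) k z<s (m≤n+m _ j) (prefixAt-map thueMorse t thueMorse≡⇒t≡ occ)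

periodicity-thueMorse : ∀ i → ∃[ k ] IsPeriodicity thueMorse i k
periodicity-thueMorse zero    = periodicity-exists thueMorse _≟_ (proj₂ (proj₂ (candidate-even 0)))
periodicity-thueMorse (suc i) = periodicity-exists thueMorse _≟_ (proj₂ (proj₂ (candidate-≤3* (suc i) z<s)))

sumTo-suc : ∀ f n → sumTo f (suc n) ≡ sumTo f n + f n
sumTo-suc f n = begin
  sum (map f (upTo (suc n)))       ≡⟨ cong (sum ∘ map f) (applyUpTo-∷ʳ (λ x → x) n) ⟨
  sum (map f (upTo n ++ n ∷ []))   ≡⟨ cong sum (map-++ f (upTo n) (n ∷ [])) ⟩
  sum (map f (upTo n) ++ f n ∷ []) ≡⟨ sum-++ (map f (upTo n)) (f n ∷ []) ⟩
  sumTo f n + (f n + 0)            ≡⟨ cong (sumTo f n +_) (+-identityʳ (f n)) ⟩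
  sumTo f n + f n                  ∎
  where open ≡-Reasoning

sumTo-2+ : ∀ f n → sumTo f (2 + n) ≡ sumTo f n + (f n + f (1 + n))
sumTo-2+ f n = begin
  sumTo f (2 + n)                 ≡⟨ sumTo-suc f (1 + n) ⟩
  sumTo f (1 + n) + f (1 + n)     ≡⟨ cong (_+ f (1 + n)) (sumTo-suc f n) ⟩
  sumTo f n + f n + f (1 + n)     ≡⟨ +-assoc (sumTo f n) (f n) (f (1 + n)) ⟩
  sumTo f n + (f n + f (1 + n))   ∎
  where open ≡-Reasoning

lower-step : ∀ n s q → 3 * (n * n) ≤ 8 * s + 2 * n → 12 * n + 8 ≤ 8 * q →
             3 * ((2 + n) * (2 + n)) ≤ 8 * (s + q) + 2 * (2 + n)
lower-step n s q ih pair = begin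
  3 * ((2 + n) * (2 + n))           ≡⟨ solve (n ∷ []) ⟩
  3 * (n * n) + (12 * n + 8) + 4    ≤⟨ +-monoˡ-≤ 4 (+-mono-≤ ih pair) ⟩
  8 * s + 2 * n + 8 * q + 4         ≡⟨ solve (n ∷ s ∷ q ∷ []) ⟩
  8 * (s + q) + 2 * (2 + n)         ∎
  where open ≤-Reasoning

upper-step : ∀ n s q → 8 * s ≤ 6 * (n * n) + 16 * n → 8 * q ≤ 24 * n + 56 →
             8 * (s + q) ≤ 6 * ((2 + n) * (2 + n)) + 16 * (2 + n)
upper-step n s q ih pair = begin
  8 * (s + q)                              ≡⟨ solve (s ∷ q ∷ []) ⟩
  8 * s + 8 * q                            ≤⟨ +-mono-≤ ih pair ⟩
  6 * (n * n) + 16 * n + (24 * n + 56)     ≡⟨ solve (n ∷ []) ⟩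
  6 * ((2 + n) * (2 + n)) + 16 * (2 + n)   ∎
  where open ≤-Reasoning

module _ (p : ℕ → ℕ) (p-spec : ∀ i → IsPeriodicity thueMorse i (p i)) where

  p≥1 : ∀ i → 1 ≤ p i
  p≥1 i = proj₁ (proj₁ (p-spec i))

  p-even≤2 : ∀ z → p (2 * z) ≤ 2
  p-even≤2 z with candidate-even z
  ... | k , k≤2 , c = ≤-trans (periodicity-≤ thueMorse (p-spec _) c) k≤2

  p≤3* : ∀ i → 1 ≤ i → p i ≤ 3 * i
  p≤3* i i≥1 with candidate-≤3* i i≥1
  ... | k , k≤3i , c = ≤-trans (periodicity-≤ thueMorse (p-spec _) c) k≤3i

  p-odd≥ : ∀ z → 3 * (1 + 2 * z) ≤ 2 * p (1 + 2 * z)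
  p-odd≥ z = candidate-odd-bound {z} (proj₁ (p-spec _))

  pair-lower : ∀ n → 12 * n + 8 ≤ 8 * (p n + p (1 + n))
  pair-lower n with parity n
  ... | even z = arith (p (2 * z)) (p (1 + 2 * z)) (p-odd≥ z)
    where
    open ≤-Reasoning
    arith : ∀ a b → 3 * (1 + 2 * z) ≤ 2 * b → 12 * (2 * z) + 8 ≤ 8 * (a + b)
    arith a b hb = begin
      12 * (2 * z) + 8         ≤⟨ ≤-offset 4 (solve (z ∷ [])) ⟩
      4 * (3 * (1 + 2 * z))    ≤⟨ *-monoʳ-≤ 4 hb ⟩
      4 * (2 * b)              ≤⟨ m≤n+m _ (8 * a) ⟩
      8 * a + 4 * (2 * b)      ≡⟨ solve (a ∷ b ∷ []) ⟩
      8 * (a + b)              ∎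
  ... | odd z = arith (p (1 + 2 * z)) (p (2 + 2 * z)) (p-odd≥ z) (p≥1 _)
    where
    open ≤-Reasoning
    arith : ∀ a b → 3 * (1 + 2 * z) ≤ 2 * a → 1 ≤ b → 12 * (1 + 2 * z) + 8 ≤ 8 * (a + b)
    arith a b ha hb = begin
      12 * (1 + 2 * z) + 8          ≡⟨ solve (z ∷ []) ⟩
      4 * (3 * (1 + 2 * z)) + 8 * 1 ≤⟨ +-mono-≤ (*-monoʳ-≤ 4 ha) (*-monoʳ-≤ 8 hb) ⟩
      4 * (2 * a) + 8 * b           ≡⟨ solve (a ∷ b ∷ []) ⟩
      8 * (a + b)                   ∎

  pair-upper : ∀ n → 8 * (p n + p (1 + n)) ≤ 24 * n + 56
  pair-upper n with parity n
  ... | even z = arith (p (2 * z)) (p (1 + 2 * z)) (p-even≤2 z) (p≤3* (1 + 2 * z) z<s)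
    where
    open ≤-Reasoning
    arith : ∀ a b → a ≤ 2 → b ≤ 3 * (1 + 2 * z) → 8 * (a + b) ≤ 24 * (2 * z) + 56
    arith a b ha hb = begin
      8 * (a + b)                   ≡⟨ solve (a ∷ b ∷ []) ⟩
      8 * a + 8 * b                 ≤⟨ +-mono-≤ (*-monoʳ-≤ 8 ha) (*-monoʳ-≤ 8 hb) ⟩
      8 * 2 + 8 * (3 * (1 + 2 * z)) ≤⟨ ≤-offset 16 (solve (z ∷ [])) ⟩
      24 * (2 * z) + 56             ∎
  ... | odd z = arith (p (1 + 2 * z)) (p (2 + 2 * z)) (p≤3* (1 + 2 * z) z<s)
                      (subst (λ x → p x ≤ 2) 2[1+z]≡2+2z (p-even≤2 (1 + z)))
    where
    open ≤-Reasoning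
    2[1+z]≡2+2z : 2 * (1 + z) ≡ 2 + 2 * z
    2[1+z]≡2+2z = solve (z ∷ [])
    arith : ∀ a b → a ≤ 3 * (1 + 2 * z) → b ≤ 2 → 8 * (a + b) ≤ 24 * (1 + 2 * z) + 56
    arith a b ha hb = begin
      8 * (a + b)                   ≡⟨ solve (a ∷ b ∷ []) ⟩
      8 * a + 8 * b                 ≤⟨ +-mono-≤ (*-monoʳ-≤ 8 ha) (*-monoʳ-≤ 8 hb) ⟩
      8 * (3 * (1 + 2 * z)) + 8 * 2 ≤⟨ ≤-offset 40 (solve (z ∷ [])) ⟩
      24 * (1 + 2 * z) + 56         ∎

  sum-lower : ∀ n → 3 * (n * n) ≤ 8 * sumTo p n + 2 * n
  sum-lower zero = z≤n
  sum-lower (suc zero) rewrite sumTo-suc p 0 =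
    ≤-trans (≤-offset 7 refl) (+-monoˡ-≤ 2 (*-monoʳ-≤ 8 (p≥1 0)))
  sum-lower (suc (suc n)) rewrite sumTo-2+ p n =
    lower-step n (sumTo p n) (p n + p (1 + n)) (sum-lower n) (pair-lower n)

  sum-upper : ∀ n → 8 * sumTo p n ≤ 6 * (n * n) + 16 * n
  sum-upper zero = z≤n
  sum-upper (suc zero) rewrite sumTo-suc p 0 =
    ≤-trans (*-monoʳ-≤ 8 (p-even≤2 0)) (≤-offset 6 refl)
  sum-upper (suc (suc n)) rewrite sumTo-2+ p n =
    upper-step n (sumTo p n) (p n + p (1 + n)) (sum-upper n) (pair-upper n)

theorem3 : ((i : ℕ) → Σ ℕ (λ k → IsPeriodicity thueMorse i k))
           × ((p : ℕ → ℕ) → ((i : ℕ) → IsPeriodicity thueMorse i (p i)) →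
              (n : ℕ) → 1 ≤ n →
              (3 * (n * n) ≤ 8 * sumTo p n + 2 * n)
              × (8 * sumTo p n ≤ 6 * (n * n) + 16 * n))
theorem3 = periodicity-thueMorse , λ p p-spec n _ → sum-lower p p-spec n , sum-upper p p-spec n
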